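{- Let $G=(V,E)$ be a bipartite graph and let $S$ be a secure dominating set of $G$. Then $|\mathrm{epn}(v,S)|\le 1$ for every $v\in V$.
   Context: All graphs are finite, simple and undirected. A set $S\subseteq V$ is a dominating set if every vertex of $V\setminus S$ has a neighbor in $S$. A dominating set $S$ is a secure dominating set (SDS) if for each $u\in V\setminus S$ there exists a neighbor $v\in S$ of $u$ such that $(S\setminus\{v\})\cup\{u\}$ is a dominating set of $G$. For $S\subseteq V$ and $v\in V$, a vertex $w\in V\setminus S$ is an external private neighbor of $v$ with respect to $S$ if $N[w]\cap S=\{v\}$, where $N[w]$ is the closed neighborhood of $w$; $\mathrm{epn}(v,S)$ denotes the set of external private neighbors of $v$ with respect to $S$. -}

module Defs where

open import Data.Nat using (ℕ)
open import Data.Bool using (Bool; true; false; _∧_; _∨_; not) renaming (_≟_ to _≟ᵇ_)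
open import Data.Fin using (Fin; _≟_)
open import Data.Fin.Subset using (Subset; _∈_; _∉_; ⁅_⁆; _∪_; _─_; ∣_∣)
open import Data.Vec using (tabulate; lookup)
open import Data.List using (List; []; _∷_; allFin)
open import Data.Product using (Σ; ∃; _×_)
open import Relation.Binary.PropositionalEquality using (_≡_; _≢_)
open import Relation.Nullary using (¬_; does)

allᵇ : {A : Set} → (A → Bool) → List A → Bool
allᵇ p [] = true
allᵇ p (x ∷ xs) = p x ∧ allᵇ p xs

record Graph (n : ℕ) : Set where
  field
    adj   : Fin n → Fin n → Bool
    sym   : ∀ u v → adj u v ≡ adj v u
    irrefl : ∀ v → adj v v ≡ false

module _ {n : ℕ} (G : Graph n) where
  open Graph G

  Adj : Fin n → Fin n → Set
  Adj u v = adj u v ≡ true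

  Bipartite : Set
  Bipartite = Σ (Fin n → Bool) λ c → ∀ u v → Adj u v → c u ≢ c v

  Dominating : Subset n → Set
  Dominating S = ∀ u → u ∉ S → ∃ λ v → v ∈ S × Adj u v

  SecureDominating : Subset n → Set
  SecureDominating S =
    Dominating S ×
    (∀ u → u ∉ S → ∃ λ v → v ∈ S × Adj u v × Dominating ((S ─ ⁅ v ⁆) ∪ ⁅ u ⁆))

  closedNbhd : Fin n → Subset n
  closedNbhd w = tabulate λ x → does (x ≟ w) ∨ adj w x

  private
    _≡ᵇ_ : Bool → Bool → Bool
    a ≡ᵇ b = does (a ≟ᵇ b)

    _=ᵇ_ : Fin n → Fin n → Bool
    x =ᵇ y = does (x ≟ y)

  -- epn(v,S): the set of w ∉ S with N[w] ∩ S = {v}, i.e. w ∉ S and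
  -- for every vertex x:  (x ∈ N[w] and x ∈ S)  ⇔  x = v.
  epn : Fin n → Subset n → Subset n
  epn v S = tabulate λ w →
    not (lookup S w) ∧
    allᵇ (λ x → (lookup (closedNbhd w) x ∧ lookup S x) ≡ᵇ (x =ᵇ v)) (allFin n)

-- If w₁ ≠ w₂ were both external private neighbours of v, the vertex defending w₁ is a
-- neighbour of w₁ in S, hence v itself.  After swapping v for w₁, the vertex w₂ lost its
-- only neighbour v in S, so it must be adjacent to w₁; then w₁ w₂ v is a triangle, which
-- a bipartite graph does not contain.
module Submission where

open import Defs
open import Data.Nat using (ℕ; _≤_; z≤n)
open import Data.Nat.Properties using (≤-trans; ≤-reflexive)
open import Data.Bool using (Bool; true; false; _∧_; _∨_; not)
import Data.Bool as Bool
open import Data.Bool.Properties using (∧-conicalˡ; ∧-conicalʳ; ∨-sel; ∨-zeroʳ)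
open import Data.Fin using (Fin; _≟_)
open import Data.Fin.Subset using (Subset; _∈_; _∉_; ⁅_⁆; _∪_; _─_; ∣_∣)
open import Data.Fin.Subset.Properties
  using (nonempty?; Empty-unique; ∣⊥∣≡0; ∣⁅x⁆∣≡1; p⊆q⇒∣p∣≤∣q∣; x∈⁅x⁆; x∈⁅y⁆⇒x≡y; x∈p∪q⁻; p─q⊆p)
open import Data.Vec using (_∷_; tabulate; lookup; there)
open import Data.Vec.Properties using ([]=⇒lookup; lookup⇒[]=; lookup∘tabulate)
open import Data.List using (List; []; _∷_; allFin)
open import Data.List.Relation.Unary.All as All using (All; []; _∷_)
open import Data.List.Membership.Propositional.Properties using (∈-allFin)
open import Data.Product using (∃; _×_; _,_; proj₁; proj₂)
open import Data.Sum using (_⊎_; inj₁; inj₂)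
open import Data.Empty using (⊥; ⊥-elim)
open import Relation.Binary.PropositionalEquality using (_≡_; _≢_; refl; sym; trans; cong; cong₂; subst)
open import Relation.Nullary using (¬_; Dec; yes; no; does; contradiction)
open import Relation.Nullary.Decidable using (dec-true)

does⇒ : ∀ {A : Set} (a? : Dec A) → does a? ≡ true → A
does⇒ (yes a) _ = a

∧-true⁻ : ∀ {a b} → a ∧ b ≡ true → a ≡ true × b ≡ true
∧-true⁻ {a} {b} a∧b = ∧-conicalˡ a b a∧b , ∧-conicalʳ a b a∧b

∨-true⁻ : ∀ {a b} → a ∨ b ≡ true → a ≡ true ⊎ b ≡ true
∨-true⁻ {a} {b} a∨b with ∨-sel a b
... | inj₁ a∨b≡a = inj₁ (trans (sym a∨b≡a) a∨b)
... | inj₂ a∨b≡b = inj₂ (trans (sym a∨b≡b) a∨b)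

≢-≢⇒≡ : ∀ {x y z : Bool} → x ≢ y → y ≢ z → x ≡ z
≢-≢⇒≡ {false} {false} x≢y _ = contradiction refl x≢y
≢-≢⇒≡ {true}  {true}  x≢y _ = contradiction refl x≢y
≢-≢⇒≡ {_} {false} {false} _ y≢z = contradiction refl y≢z
≢-≢⇒≡ {_} {true}  {true}  _ y≢z = contradiction refl y≢z
≢-≢⇒≡ {false} {true} {false} _ _ = refl
≢-≢⇒≡ {true} {false} {true}  _ _ = refl

allᵇ⇒All : ∀ {A : Set} {p : A → Bool} (xs : List A) → allᵇ p xs ≡ true → All (λ x → p x ≡ true) xs
allᵇ⇒All []       _   = []
allᵇ⇒All (x ∷ xs) all = proj₁ (∧-true⁻ all) ∷ allᵇ⇒All xs (proj₂ (∧-true⁻ all))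

∈tabulate⁻ : ∀ {n} {f : Fin n → Bool} {x} → x ∈ tabulate f → f x ≡ true
∈tabulate⁻ {f = f} {x} x∈ = trans (sym (lookup∘tabulate f x)) ([]=⇒lookup x∈)

∈tabulate⁺ : ∀ {n} {f : Fin n → Bool} {x} → f x ≡ true → x ∈ tabulate f
∈tabulate⁺ {f = f} {x} fx = lookup⇒[]= x _ (trans (lookup∘tabulate f x) fx)

x∈p─q⇒x∉q : ∀ {n} {x : Fin n} (p q : Subset n) → x ∈ p ─ q → x ∉ q
x∈p─q⇒x∉q (_ ∷ p) (true  ∷ q) (there x∈p─q) (there x∈q) = x∈p─q⇒x∉q p q x∈p─q x∈q
x∈p─q⇒x∉q (_ ∷ p) (false ∷ q) (there x∈p─q) (there x∈q) = x∈p─q⇒x∉q p q x∈p─q x∈q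

∣p∣≤1 : ∀ {n} (p : Subset n) → (∀ {x y} → x ∈ p → y ∈ p → x ≡ y) → ∣ p ∣ ≤ 1
∣p∣≤1 {n} p unique with nonempty? p
... | yes (x , x∈p) =
  ≤-trans (p⊆q⇒∣p∣≤∣q∣ λ y∈p → subst (_∈ ⁅ x ⁆) (unique x∈p y∈p) (x∈⁅x⁆ x)) (≤-reflexive (∣⁅x⁆∣≡1 x))
... | no empty = subst (_≤ 1) (sym (trans (cong ∣_∣ (Empty-unique empty)) (∣⊥∣≡0 n))) z≤n

module _ {n : ℕ} (G : Graph n) where

  Adj-sym : ∀ {u v} → Adj G u v → Adj G v u
  Adj-sym {u} {v} u~v = trans (Graph.sym G v u) u~v

  TriangleFree : Set
  TriangleFree = ∀ {a b c} → Adj G a b → Adj G b c → Adj G c a → ⊥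

  bipartite⇒triangleFree : Bipartite G → TriangleFree
  bipartite⇒triangleFree (_ , proper) {a} {b} {c} a~b b~c c~a =
    proper c a c~a (sym (≢-≢⇒≡ (proper a b a~b) (proper b c b~c)))

  closedNbhd⁻ : ∀ {w x} → x ∈ closedNbhd G w → x ≡ w ⊎ Adj G w x
  closedNbhd⁻ {w} {x} x∈N with ∨-true⁻ (∈tabulate⁻ x∈N)
  ... | inj₁ x≟w = inj₁ (does⇒ (x ≟ w) x≟w)
  ... | inj₂ w~x = inj₂ w~x

  Adj⇒∈closedNbhd : ∀ {w x} → Adj G w x → x ∈ closedNbhd G w
  Adj⇒∈closedNbhd {w} {x} w~x =
    ∈tabulate⁺ (trans (cong (does (x ≟ w) ∨_) w~x) (∨-zeroʳ (does (x ≟ w))))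

  record PrivateNeighbour (S : Subset n) (v w : Fin n) : Set where
    field
      nonmember : w ∉ S
      adjacent  : Adj G w v
      unique    : ∀ {x} → x ∈ S → Adj G w x → x ≡ v

  open PrivateNeighbour

  ∈epn⇒PrivateNeighbour : ∀ {S v w} → w ∈ epn G v S → PrivateNeighbour S v w
  ∈epn⇒PrivateNeighbour {S} {v} {w} w∈epn = record
    { nonmember = w∉S
    ; adjacent  = v-adjacent
    ; unique    = λ x∈S w~x → N[w]∩S⊆⁅v⁆ x∈S (Adj⇒∈closedNbhd w~x)
    }
    where
    entry : not (lookup S w) ≡ true ×
      allᵇ (λ x → does ((lookup (closedNbhd G w) x ∧ lookup S x) Bool.≟ does (x ≟ v))) (allFin n) ≡ true
    entry = ∧-true⁻ (∈tabulate⁻ w∈epn)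

    w∉S : w ∉ S
    w∉S w∈S with lookup S w | []=⇒lookup w∈S | proj₁ entry
    ... | true | _ | ()

    N[w]∩S≡⁅v⁆ : ∀ x → (lookup (closedNbhd G w) x ∧ lookup S x) ≡ does (x ≟ v)
    N[w]∩S≡⁅v⁆ x = does⇒ (_ Bool.≟ _) (All.lookup (allᵇ⇒All (allFin n) (proj₂ entry)) (∈-allFin x))

    N[w]∩S⊆⁅v⁆ : ∀ {x} → x ∈ S → x ∈ closedNbhd G w → x ≡ v
    N[w]∩S⊆⁅v⁆ {x} x∈S x∈N = does⇒ (x ≟ v)
      (trans (sym (N[w]∩S≡⁅v⁆ x)) (cong₂ _∧_ ([]=⇒lookup x∈N) ([]=⇒lookup x∈S)))

    v∈N[w]∩S : lookup (closedNbhd G w) v ∧ lookup S v ≡ true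
    v∈N[w]∩S = trans (N[w]∩S≡⁅v⁆ v) (dec-true (v ≟ v) refl)

    v-adjacent : Adj G w v
    v-adjacent with closedNbhd⁻ (lookup⇒[]= v _ (proj₁ (∧-true⁻ v∈N[w]∩S)))
    ... | inj₂ w~v = w~v
    ... | inj₁ refl = ⊥-elim (w∉S (lookup⇒[]= v S (proj₂ (∧-true⁻ v∈N[w]∩S))))

  privateNeighbour-unique : TriangleFree → ∀ {S} → SecureDominating G S →
    ∀ {v w₁ w₂} → PrivateNeighbour S v w₁ → PrivateNeighbour S v w₂ → w₁ ≡ w₂
  privateNeighbour-unique triangleFree {S} (_ , secure) {v} {w₁} {w₂} pn₁ pn₂ with w₁ ≟ w₂
  ... | yes w₁≡w₂ = w₁≡w₂
  ... | no w₁≢w₂ with secure w₁ (nonmember pn₁)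
  ... | u , u∈S , w₁~u , swapDominating with unique pn₁ u∈S w₁~u
  ... | refl = ⊥-elim (w₂-undominated (swapDominating w₂ w₂∉swap))
    where
    w₂∉swap : w₂ ∉ (S ─ ⁅ v ⁆) ∪ ⁅ w₁ ⁆
    w₂∉swap w₂∈swap with x∈p∪q⁻ (S ─ ⁅ v ⁆) ⁅ w₁ ⁆ w₂∈swap
    ... | inj₁ w₂∈S─v = nonmember pn₂ (p─q⊆p S ⁅ v ⁆ w₂∈S─v)
    ... | inj₂ w₂∈⁅w₁⁆ = w₁≢w₂ (sym (x∈⁅y⁆⇒x≡y w₁ w₂∈⁅w₁⁆))

    w₂-undominated : ¬ ∃ λ x → x ∈ (S ─ ⁅ v ⁆) ∪ ⁅ w₁ ⁆ × Adj G w₂ x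
    w₂-undominated (x , x∈swap , w₂~x) with x∈p∪q⁻ (S ─ ⁅ v ⁆) ⁅ w₁ ⁆ x∈swap
    ... | inj₁ x∈S─v = x∈p─q⇒x∉q S ⁅ v ⁆ x∈S─v
          (subst (_∈ ⁅ v ⁆) (sym (unique pn₂ (p─q⊆p S ⁅ v ⁆ x∈S─v) w₂~x)) (x∈⁅x⁆ v))
    ... | inj₂ x∈⁅w₁⁆ with x∈⁅y⁆⇒x≡y w₁ x∈⁅w₁⁆
    ... | refl = triangleFree w₂~x (adjacent pn₁) (Adj-sym (adjacent pn₂))

corollary1 : (n : ℕ) (G : Graph n) → Bipartite G →
    (S : Subset n) → SecureDominating G S →
    (v : Fin n) → ∣ epn G v S ∣ ≤ 1
corollary1 n G bipartite S secure v = ∣p∣≤1 (epn G v S) λ w₁∈epn w₂∈epn →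
  privateNeighbour-unique G (bipartite⇒triangleFree G bipartite) secure
    (∈epn⇒PrivateNeighbour G w₁∈epn) (∈epn⇒PrivateNeighbour G w₂∈epn)
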